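{- Let $\Phi$ be a connected, twin reduced signed digraph on $4$ vertices whose Eisenstein matrix has rank $3$. Then $\Phi$ is switching isomorphic to $(T_4,+)$ or to $(T_4,-)$.
   Context: Let $\omega=e^{i\pi/3}$ and $\mathbb{T}_6=\{\omega^k: k=0,\dots,5\}$. A signed digraph $\Phi=(G,\varphi)$ consists of a finite simple graph $G$ and a map $\varphi$ assigning to every ordered pair $(u,v)$ of adjacent vertices a value $\varphi(u,v)\in\mathbb{T}_6$ with $\varphi(v,u)=\overline{\varphi(u,v)}$; it is connected if $G$ is. Its Eisenstein matrix $\mathcal{E}=\mathcal{E}(\Phi)$ has $\mathcal{E}_{uv}=\varphi(u,v)$ for adjacent $u,v$ and $0$ otherwise. Two distinct vertices $u,v$ are (switching) twins if there is a diagonal matrix $X$ with diagonal entries in $\mathbb{T}_6$ such that $\mathcal{E}_{uz}=(X\mathcal{E}X^{ -1})_{vz}$ for all vertices $z$; $\Phi$ is twin reduced if it has no pair of twins. $(T_4,+)$ is the signed digraph on $\{1,2,3,4\}$ with $\mathcal{E}_{uv}=\omega$ for $u<v$ and $\mathcal{E}_{uv}=\overline\omega$ for $u>v$; $(T_4,-)$ has Eisenstein matrix $-\mathcal{E}((T_4,+))$. Two signed digraphs are switching isomorphic if one can be obtained from the other by a sequence of the operations: $\mathcal{E}\mapsto X\mathcal{E}X^{ -1}$ with $X$ diagonal with diagonal entries in $\mathbb{T}_6$; relabeling vertices; taking the converse ($\mathcal{E}\mapsto\mathcal{E}^\top$). -}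

module Defs where

open import Data.Nat using (ℕ; zero; suc)
open import Data.Integer as ℤ using (ℤ; +_; -[1+_])
open import Data.Fin using (Fin; zero; suc; toℕ; punchIn)
open import Data.Fin.Permutation using (Permutation′; _⟨$⟩ʳ_)
open import Data.Maybe using (Maybe; just; nothing; maybe; Is-just)
import Data.Maybe as Maybe
open import Data.Product using (Σ; ∃; _×_; _,_)
open import Data.Sum using (_⊎_)
open import Relation.Binary.PropositionalEquality using (_≡_; _≢_)
open import Relation.Binary.Construct.Closure.ReflexiveTransitive using (Star)
open import Relation.Nullary using (¬_)
import Data.Nat as ℕ

-- Eisenstein integers ℤ[ω], ω = e^{iπ/3}, ω² = ω - 1.
-- The element a + b ω is represented by the pair (a , b); this
-- representation is unique, so ≡ is the equality of complex numbers.

record ℤω : Set where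
  constructor _+_ω
  field
    re : ℤ
    im : ℤ
open ℤω public

0ω : ℤω
0ω = (+ 0) + (+ 0) ω

_+ω_ : ℤω → ℤω → ℤω
(a + b ω) +ω (c + d ω) = (a ℤ.+ c) + (b ℤ.+ d) ω

-ω_ : ℤω → ℤω
-ω (a + b ω) = (ℤ.- a) + (ℤ.- b) ω

-- (a + bω)(c + dω) = ac + (ad + bc)ω + bd(ω - 1)
_*ω_ : ℤω → ℤω → ℤω
(a + b ω) *ω (c + d ω) =
  (a ℤ.* c ℤ.- b ℤ.* d) + (a ℤ.* d ℤ.+ b ℤ.* c ℤ.+ b ℤ.* d) ω

-- complex conjugation: conj ω = 1 - ω
conj : ℤω → ℤω
conj (a + b ω) = (a ℤ.+ b) + (ℤ.- b) ω

infixl 6 _+ω_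
infixl 7 _*ω_

-- 𝕋₆ = {ω^k : k = 0..5}, represented by the exponent k : Fin 6.

T6 : Set
T6 = Fin 6

⟦_⟧ : T6 → ℤω
⟦ zero ⟧                         = (+ 1)    + (+ 0) ω
⟦ suc zero ⟧                     = (+ 0)    + (+ 1) ω
⟦ suc (suc zero) ⟧               = -[1+ 0 ] + (+ 1) ω
⟦ suc (suc (suc zero)) ⟧         = -[1+ 0 ] + (+ 0) ω
⟦ suc (suc (suc (suc zero))) ⟧   = (+ 0)    + -[1+ 0 ] ω
⟦ suc (suc (suc (suc (suc zero)))) ⟧ = (+ 1) + -[1+ 0 ] ω

conj6 : T6 → T6
conj6 zero = zero
conj6 (suc zero) = suc (suc (suc (suc (suc zero))))
conj6 (suc (suc zero)) = suc (suc (suc (suc zero)))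
conj6 (suc (suc (suc zero))) = suc (suc (suc zero))
conj6 (suc (suc (suc (suc zero)))) = suc (suc zero)
conj6 (suc (suc (suc (suc (suc zero))))) = suc zero

Mat : ℕ → Set
Mat n = Fin n → Fin n → ℤω

det : ∀ {n} → (Fin n → Fin n → ℤω) → ℤω
det {zero} A = (+ 1) + (+ 0) ω
det {suc n} A = sumFin (λ j → sign j *ω A zero j *ω det (minor j))
  where
  sign : ∀ {m} → Fin m → ℤω
  sign j with ℕ._%_ (toℕ j) 2
  ... | zero = (+ 1) + (+ 0) ω
  ... | suc _ = -[1+ 0 ] + (+ 0) ω
  minor : Fin (suc n) → Fin n → Fin n → ℤω
  minor j r c = A (suc r) (punchIn j c)
  sumFin : ∀ {m} → (Fin m → ℤω) → ℤω
  sumFin {zero} f = 0ω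
  sumFin {suc m} f = f zero +ω sumFin (λ i → f (suc i))

-- Determinantal rank: A has rank r iff some r×r submatrix has nonzero
-- determinant and every (r+1)×(r+1) submatrix has zero determinant.
-- (Submatrices are given by arbitrary row/column selections
-- f g : Fin k → Fin n; repeated indices only give zero determinants,
-- so this is the usual notion.)
HasRank : ∀ {n} → Mat n → ℕ → Set
HasRank {n} A r =
  (∃ λ (f : Fin r → Fin n) → ∃ λ (g : Fin r → Fin n) →
      det (λ i j → A (f i) (g j)) ≢ 0ω)
  × (∀ (f g : Fin (suc r) → Fin n) → det (λ i j → A (f i) (g j)) ≡ 0ω)

-- Signed digraphs on vertex set Fin n.
-- arc u v = nothing  : u, v not adjacent
-- arc u v = just k   : u, v adjacent with φ(u,v) = ω^k
-- The graph is simple (no loops) and φ(v,u) = conj φ(u,v).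

record SignedDigraph (n : ℕ) : Set where
  field
    arc      : Fin n → Fin n → Maybe T6
    loopless : ∀ u → arc u u ≡ nothing
    conjSym  : ∀ u v → arc v u ≡ Maybe.map conj6 (arc u v)
open SignedDigraph public

Adjacent : ∀ {n} → SignedDigraph n → Fin n → Fin n → Set
Adjacent Φ u v = Is-just (arc Φ u v)

Connected : ∀ {n} → SignedDigraph n → Set
Connected {n} Φ = ∀ (u v : Fin n) → Star (Adjacent Φ) u v

Eis : ∀ {n} → SignedDigraph n → Mat n
Eis Φ u v = maybe ⟦_⟧ 0ω (arc Φ u v)

-- switching twins: u ≠ v and ∃ diagonal X over 𝕋₆ with
-- E_{uz} = (X E X⁻¹)_{vz} = X_v E_{vz} conj(X_z) for all z
Twins : ∀ {n} → SignedDigraph n → Fin n → Fin n → Set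
Twins {n} Φ u v =
  u ≢ v × ∃ λ (X : Fin n → T6) →
    ∀ z → Eis Φ u z ≡ ⟦ X v ⟧ *ω Eis Φ v z *ω conj ⟦ X z ⟧

TwinReduced : ∀ {n} → SignedDigraph n → Set
TwinReduced {n} Φ = ∀ (u v : Fin n) → ¬ Twins Φ u v

data SwitchStep {n : ℕ} (A B : Mat n) : Set where
  switching : (X : Fin n → T6) →
    (∀ u v → B u v ≡ ⟦ X u ⟧ *ω A u v *ω conj ⟦ X v ⟧) → SwitchStep A B
  relabel : (σ : Permutation′ n) →
    (∀ u v → B u v ≡ A (σ ⟨$⟩ʳ u) (σ ⟨$⟩ʳ v)) → SwitchStep A B
  converse : (∀ u v → B u v ≡ A v u) → SwitchStep A B

SwitchingIsomorphic : ∀ {n} → Mat n → Mat n → Set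
SwitchingIsomorphic = Star SwitchStep

-- (T₄,+) and (T₄,-) on vertices Fin 4 (vertex i ↔ i+1)

T4+ : Mat 4
T4+ u v with toℕ u ℕ.<? toℕ v | toℕ v ℕ.<? toℕ u
... | Relation.Nullary.yes _ | _ = ⟦ suc zero ⟧
... | Relation.Nullary.no _ | Relation.Nullary.yes _ = ⟦ suc (suc (suc (suc (suc zero)))) ⟧
... | Relation.Nullary.no _ | Relation.Nullary.no _ = 0ω

T4- : Mat 4
T4- u v = -ω (T4+ u v)

-- Non-adjacent vertices with the same neighbours are twins, since switching can then match
-- their arcs; a finite check over the 64 graphs on four vertices leaves K₄, the path and the
-- triangle with a pendant edge as the connected twin-free ones. The determinant of a hollow
-- 4 × 4 matrix is the sum over perfect matchings minus the sum over directed Hamiltonian cycles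
-- of the products of the entries. The path and the pendant triangle have a unique perfect
-- matching and no Hamiltonian cycle, so their Eisenstein matrices have determinant 1 and rank 4.
-- A complete signed graph is switched so that the arcs out of vertex 0 carry 1; switching
-- preserves the weights of closed walks and hence the determinant, and a search over the 216
-- resulting normal forms shows that those of determinant 0 are relabelled and switched copies
-- of (T₄,+) or (T₄,−).

module Submission where

open import Defs
open import Function using (_∘_; id)
open import Algebra.Bundles using (CommutativeRing)
open import Data.Bool using (Bool; true; false)
import Data.Bool.Properties as Bool
open import Data.Empty using (⊥-elim)
open import Data.Fin using (Fin; zero; suc; toℕ; punchIn)
open import Data.Fin.Patterns using (0F; 1F; 2F; 3F; 5F)
open import Data.Fin.Permutation using (Permutation′; _⟨$⟩ʳ_; transpose; _∘ₚ_)
import Data.Fin.Permutation as Perm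
open import Data.Fin.Properties using (all?) renaming (_≟_ to _≟ᶠ_)
open import Data.Fin.Subset using (Subset; _∈_; ⊤; inside; outside)
open import Data.Fin.Subset.Properties using (_∈?_)
open import Data.Integer as ℤ using (+_; -[1+_])
import Data.Integer.Properties as ℤ
open import Data.Integer.Tactic.RingSolver using (solve-∀)
open import Data.List using (List; []; _∷_; foldr; map)
import Data.List.Properties as List
open import Data.List.Relation.Unary.All using (All; []; _∷_)
import Data.List.Relation.Unary.All as All
import Data.List.Relation.Unary.All.Properties as All
open import Data.List.Relation.Unary.Any using (Any; here; there; satisfied)
import Data.List.Relation.Unary.Any as Any
open import Data.Maybe using (Maybe; just; nothing; is-just; Is-just)
import Data.Maybe as Maybe
open import Data.Nat as ℕ using (zero; suc)
open import Data.Nat.DivMod using (_mod_)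
open import Data.Product using (_×_; _,_; ∃; proj₂; uncurry)
open import Data.Sum using (_⊎_; inj₁; inj₂)
import Data.Sum as Sum
open import Data.Vec using (Vec; lookup; tabulate) renaming ([] to []ᵛ; _∷_ to _∷ᵛ_)
import Data.Vec as Vec
import Data.Vec.Properties as Vecₚ
open import Relation.Binary.Construct.Closure.ReflexiveTransitive using (Star; ε; _◅_; _◅◅_)
open import Relation.Binary.Definitions using (DecidableEquality)
open import Relation.Binary.PropositionalEquality
open import Algebra.Structures {A = ℤω} _≡_ using (IsCommutativeRing)
open import Relation.Nullary using (Dec; yes; no; ¬_)
open import Relation.Nullary.Decidable using (from-yes; map′; _×-dec_; _⊎-dec_; _→-dec_; ¬?)
open import Tactic.RingSolver.Core.AlmostCommutativeRing using (fromCommutativeRing)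
import Tactic.RingSolver.NonReflective as NonReflective

1ω : ℤω
1ω = (+ 1) + (+ 0) ω

infix 4 _≟ω_
_≟ω_ : DecidableEquality ℤω
(a + b ω) ≟ω (c + d ω) with a ℤ.≟ c | b ℤ.≟ d
... | yes refl | yes refl = yes refl
... | no a≢c   | _        = no λ { refl → a≢c refl }
... | yes _    | no b≢d   = no λ { refl → b≢d refl }

*ω-assoc : ∀ x y z → (x *ω y) *ω z ≡ x *ω (y *ω z)
*ω-assoc (a + b ω) (c + d ω) (e + f ω) = cong₂ _+_ω (real a b c d e f) (imag a b c d e f)
  where
  real : ∀ a b c d e f → (a ℤ.* c ℤ.- b ℤ.* d) ℤ.* e ℤ.- (a ℤ.* d ℤ.+ b ℤ.* c ℤ.+ b ℤ.* d) ℤ.* f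
    ≡ a ℤ.* (c ℤ.* e ℤ.- d ℤ.* f) ℤ.- b ℤ.* (c ℤ.* f ℤ.+ d ℤ.* e ℤ.+ d ℤ.* f)
  real = solve-∀
  imag : ∀ a b c d e f →
    (a ℤ.* c ℤ.- b ℤ.* d) ℤ.* f ℤ.+ (a ℤ.* d ℤ.+ b ℤ.* c ℤ.+ b ℤ.* d) ℤ.* e
      ℤ.+ (a ℤ.* d ℤ.+ b ℤ.* c ℤ.+ b ℤ.* d) ℤ.* f
    ≡ a ℤ.* (c ℤ.* f ℤ.+ d ℤ.* e ℤ.+ d ℤ.* f) ℤ.+ b ℤ.* (c ℤ.* e ℤ.- d ℤ.* f)
      ℤ.+ b ℤ.* (c ℤ.* f ℤ.+ d ℤ.* e ℤ.+ d ℤ.* f)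
  imag = solve-∀

*ω-comm : ∀ x y → x *ω y ≡ y *ω x
*ω-comm (a + b ω) (c + d ω) = cong₂ _+_ω (real a b c d) (imag a b c d)
  where
  real : ∀ a b c d → a ℤ.* c ℤ.- b ℤ.* d ≡ c ℤ.* a ℤ.- d ℤ.* b
  real = solve-∀
  imag : ∀ a b c d → a ℤ.* d ℤ.+ b ℤ.* c ℤ.+ b ℤ.* d ≡ c ℤ.* b ℤ.+ d ℤ.* a ℤ.+ d ℤ.* b
  imag = solve-∀

*ω-identityʳ : ∀ x → x *ω 1ω ≡ x
*ω-identityʳ (a + b ω) = cong₂ _+_ω (real a b) (imag a b)
  where
  real : ∀ a b → a ℤ.* + 1 ℤ.- b ℤ.* + 0 ≡ a
  real = solve-∀
  imag : ∀ a b → a ℤ.* + 0 ℤ.+ b ℤ.* + 1 ℤ.+ b ℤ.* + 0 ≡ b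
  imag = solve-∀

*ω-identityˡ : ∀ x → 1ω *ω x ≡ x
*ω-identityˡ x = trans (*ω-comm 1ω x) (*ω-identityʳ x)

*ω-distribˡ : ∀ x y z → x *ω (y +ω z) ≡ x *ω y +ω x *ω z
*ω-distribˡ (a + b ω) (c + d ω) (e + f ω) = cong₂ _+_ω (real a b c d e f) (imag a b c d e f)
  where
  real : ∀ a b c d e f →
    a ℤ.* (c ℤ.+ e) ℤ.- b ℤ.* (d ℤ.+ f) ≡ (a ℤ.* c ℤ.- b ℤ.* d) ℤ.+ (a ℤ.* e ℤ.- b ℤ.* f)
  real = solve-∀
  imag : ∀ a b c d e f →
    a ℤ.* (d ℤ.+ f) ℤ.+ b ℤ.* (c ℤ.+ e) ℤ.+ b ℤ.* (d ℤ.+ f)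
    ≡ (a ℤ.* d ℤ.+ b ℤ.* c ℤ.+ b ℤ.* d) ℤ.+ (a ℤ.* f ℤ.+ b ℤ.* e ℤ.+ b ℤ.* f)
  imag = solve-∀

*ω-distribʳ : ∀ x y z → (y +ω z) *ω x ≡ y *ω x +ω z *ω x
*ω-distribʳ x y z = begin
  (y +ω z) *ω x     ≡⟨ *ω-comm (y +ω z) x ⟩
  x *ω (y +ω z)     ≡⟨ *ω-distribˡ x y z ⟩
  x *ω y +ω x *ω z  ≡⟨ cong₂ _+ω_ (*ω-comm x y) (*ω-comm x z) ⟩
  y *ω x +ω z *ω x  ∎
  where open ≡-Reasoning

ℤω-isCommutativeRing : IsCommutativeRing _+ω_ _*ω_ -ω_ 0ω 1ω
ℤω-isCommutativeRing = record
  { isRing = record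
    { +-isAbelianGroup = record
      { isGroup = record
        { isMonoid = record
          { isSemigroup = record
            { isMagma = record { isEquivalence = isEquivalence ; ∙-cong = cong₂ _+ω_ }
            ; assoc = λ { (a + b ω) (c + d ω) (e + f ω) →
                cong₂ _+_ω (ℤ.+-assoc a c e) (ℤ.+-assoc b d f) } }
          ; identity = (λ { (a + b ω) → cong₂ _+_ω (ℤ.+-identityˡ a) (ℤ.+-identityˡ b) })
                     , (λ { (a + b ω) → cong₂ _+_ω (ℤ.+-identityʳ a) (ℤ.+-identityʳ b) }) }
        ; inverse = (λ { (a + b ω) → cong₂ _+_ω (ℤ.+-inverseˡ a) (ℤ.+-inverseˡ b) })
                  , (λ { (a + b ω) → cong₂ _+_ω (ℤ.+-inverseʳ a) (ℤ.+-inverseʳ b) })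
        ; ⁻¹-cong = cong -ω_ }
      ; comm = λ { (a + b ω) (c + d ω) → cong₂ _+_ω (ℤ.+-comm a c) (ℤ.+-comm b d) } }
    ; *-cong = cong₂ _*ω_
    ; *-assoc = *ω-assoc
    ; *-identity = *ω-identityˡ , *ω-identityʳ
    ; distrib = *ω-distribˡ , *ω-distribʳ }
  ; *-comm = *ω-comm }

ℤω-commutativeRing : CommutativeRing _ _
ℤω-commutativeRing = record { isCommutativeRing = ℤω-isCommutativeRing }

open CommutativeRing ℤω-commutativeRing using (zeroˡ; zeroʳ; +-identityʳ)

private
  0ω≟ : ∀ x → Maybe (0ω ≡ x)
  0ω≟ ((+ 0) + (+ 0) ω) = just refl
  0ω≟ _                 = nothing

module ℤωSolver = NonReflective (fromCommutativeRing ℤω-commutativeRing 0ω≟)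

infixl 7 _·_
_·_ : T6 → T6 → T6
x · y = (toℕ x ℕ.+ toℕ y) mod 6

infix 8 _⁻¹
_⁻¹ : T6 → T6
_⁻¹ = conj6

⟦⟧*⟦⁻¹⟧≡1 : ∀ x → ⟦ x ⟧ *ω ⟦ x ⁻¹ ⟧ ≡ 1ω
⟦⟧*⟦⁻¹⟧≡1 = from-yes (all? λ x → ⟦ x ⟧ *ω ⟦ x ⁻¹ ⟧ ≟ω 1ω)

conj⟦⟧*⟦⟧≡1 : ∀ x → conj ⟦ x ⟧ *ω ⟦ x ⟧ ≡ 1ω
conj⟦⟧*⟦⟧≡1 = from-yes (all? λ x → conj ⟦ x ⟧ *ω ⟦ x ⟧ ≟ω 1ω)

⟦⟧*conj⟦⟧≡1 : ∀ x → ⟦ x ⟧ *ω conj ⟦ x ⟧ ≡ 1ω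
⟦⟧*conj⟦⟧≡1 = from-yes (all? λ x → ⟦ x ⟧ *ω conj ⟦ x ⟧ ≟ω 1ω)

⟦⟧-switch : ∀ x k y → ⟦ x · k · y ⁻¹ ⟧ ≡ ⟦ x ⟧ *ω ⟦ k ⟧ *ω conj ⟦ y ⟧
⟦⟧-switch = from-yes (all? λ x → all? λ k → all? λ y → ⟦ x · k · y ⁻¹ ⟧ ≟ω ⟦ x ⟧ *ω ⟦ k ⟧ *ω conj ⟦ y ⟧)

fromEntries : {A : Set} → (x₀₀ x₀₁ x₀₂ x₀₃ x₁₀ x₁₁ x₁₂ x₁₃ x₂₀ x₂₁ x₂₂ x₂₃ x₃₀ x₃₁ x₃₂ x₃₃ : A) →
              Fin 4 → Fin 4 → A
fromEntries x₀₀ x₀₁ x₀₂ x₀₃ x₁₀ x₁₁ x₁₂ x₁₃ x₂₀ x₂₁ x₂₂ x₂₃ x₃₀ x₃₁ x₃₂ x₃₃ = λ where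
  0F 0F → x₀₀ ; 0F 1F → x₀₁ ; 0F 2F → x₀₂ ; 0F 3F → x₀₃
  1F 0F → x₁₀ ; 1F 1F → x₁₁ ; 1F 2F → x₁₂ ; 1F 3F → x₁₃
  2F 0F → x₂₀ ; 2F 1F → x₂₁ ; 2F 2F → x₂₂ ; 2F 3F → x₂₃
  3F 0F → x₃₀ ; 3F 1F → x₃₁ ; 3F 2F → x₃₂ ; 3F 3F → x₃₃

hollow : {A : Set} → A → (x₀₁ x₀₂ x₀₃ x₁₀ x₁₂ x₁₃ x₂₀ x₂₁ x₂₃ x₃₀ x₃₁ x₃₂ : A) → Fin 4 → Fin 4 → A
hollow o x₀₁ x₀₂ x₀₃ x₁₀ x₁₂ x₁₃ x₂₀ x₂₁ x₂₃ x₃₀ x₃₁ x₃₂ =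
  fromEntries o x₀₁ x₀₂ x₀₃ x₁₀ o x₁₂ x₁₃ x₂₀ x₂₁ o x₂₃ x₃₀ x₃₁ x₃₂ o

-- Vertex sequences u₀ u₁ u₂ u₃: the perfect matchings {u₀u₁, u₂u₃} of K₄
-- and its directed Hamiltonian cycles u₀ → u₁ → u₂ → u₃ → u₀.
perfectMatchings hamiltonianCycles : List (Vec (Fin 4) 4)
perfectMatchings =
  (0F ∷ᵛ 1F ∷ᵛ 2F ∷ᵛ 3F ∷ᵛ []ᵛ) ∷ (0F ∷ᵛ 2F ∷ᵛ 1F ∷ᵛ 3F ∷ᵛ []ᵛ) ∷ (0F ∷ᵛ 3F ∷ᵛ 1F ∷ᵛ 2F ∷ᵛ []ᵛ) ∷ []
hamiltonianCycles =
  (0F ∷ᵛ 1F ∷ᵛ 2F ∷ᵛ 3F ∷ᵛ []ᵛ) ∷ (0F ∷ᵛ 3F ∷ᵛ 2F ∷ᵛ 1F ∷ᵛ []ᵛ) ∷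
  (0F ∷ᵛ 1F ∷ᵛ 3F ∷ᵛ 2F ∷ᵛ []ᵛ) ∷ (0F ∷ᵛ 2F ∷ᵛ 3F ∷ᵛ 1F ∷ᵛ []ᵛ) ∷
  (0F ∷ᵛ 2F ∷ᵛ 1F ∷ᵛ 3F ∷ᵛ []ᵛ) ∷ (0F ∷ᵛ 3F ∷ᵛ 1F ∷ᵛ 2F ∷ᵛ []ᵛ) ∷ []

-- Generic in the ring operations, so that the ring solver can use it on expressions.
module CycleCovers {R : Set} (_+_ _*_ : R → R → R) (-_ : R → R) (0# : R) where
  matchingWeight cycleWeight : (Fin 4 → Fin 4 → R) → Vec (Fin 4) 4 → R
  matchingWeight A (u₀ ∷ᵛ u₁ ∷ᵛ u₂ ∷ᵛ u₃ ∷ᵛ []ᵛ) = (A u₀ u₁ * A u₁ u₀) * (A u₂ u₃ * A u₃ u₂)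
  cycleWeight    A (u₀ ∷ᵛ u₁ ∷ᵛ u₂ ∷ᵛ u₃ ∷ᵛ []ᵛ) = ((A u₀ u₁ * A u₁ u₂) * A u₂ u₃) * A u₃ u₀

  sum : List R → R
  sum = foldr _+_ 0#

  cycleCoverExpansion : (Fin 4 → Fin 4 → R) → R
  cycleCoverExpansion A =
    sum (map (matchingWeight A) perfectMatchings) + (- sum (map (cycleWeight A) hamiltonianCycles))

open CycleCovers _+ω_ _*ω_ -ω_ 0ω public

-- The Laplace expansion defining det, on solver expressions.
private
  detExpr : ∀ {k n} → (Fin n → Fin n → ℤωSolver.Expr ℤω k) → ℤωSolver.Expr ℤω k
  detExpr {n = zero}  A = ℤωSolver.Κ 1ω
  detExpr {k} {suc n} A = sumExpr (λ j → Κ (sign j) ⊗ A zero j ⊗ detExpr (λ r c → A (suc r) (punchIn j c)))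
    where
    open ℤωSolver
    sign : Fin (suc n) → ℤω
    sign j with toℕ j ℕ.% 2
    ... | zero  = 1ω
    ... | suc _ = -[1+ 0 ] + (+ 0) ω
    sumExpr : ∀ {m} → (Fin m → Expr ℤω k) → Expr ℤω k
    sumExpr {zero}  f = Κ 0ω
    sumExpr {suc m} f = f zero ⊕ sumExpr (λ i → f (suc i))

det-hollow : ∀ x₀₁ x₀₂ x₀₃ x₁₀ x₁₂ x₁₃ x₂₀ x₂₁ x₂₃ x₃₀ x₃₁ x₃₂ →
  let A = hollow 0ω x₀₁ x₀₂ x₀₃ x₁₀ x₁₂ x₁₃ x₂₀ x₂₁ x₂₃ x₃₀ x₃₁ x₃₂ in det A ≡ cycleCoverExpansion A
det-hollow = solve 12 (λ x₀₁ x₀₂ x₀₃ x₁₀ x₁₂ x₁₃ x₂₀ x₂₁ x₂₃ x₃₀ x₃₁ x₃₂ →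
  let A = hollow (Κ 0ω) x₀₁ x₀₂ x₀₃ x₁₀ x₁₂ x₁₃ x₂₀ x₂₁ x₂₃ x₃₀ x₃₁ x₃₂
  in detExpr A ⊜ CycleCovers.cycleCoverExpansion _⊕_ _⊗_ ⊝_ (Κ 0ω) A) refl
  where open ℤωSolver

module _ {A B : Mat 4} (A≗B : ∀ u v → A u v ≡ B u v) where

  matchingWeight-cong : ∀ m → matchingWeight A m ≡ matchingWeight B m
  matchingWeight-cong (u₀ ∷ᵛ u₁ ∷ᵛ u₂ ∷ᵛ u₃ ∷ᵛ []ᵛ) =
    cong₂ _*ω_ (cong₂ _*ω_ (A≗B u₀ u₁) (A≗B u₁ u₀)) (cong₂ _*ω_ (A≗B u₂ u₃) (A≗B u₃ u₂))

  cycleWeight-cong : ∀ c → cycleWeight A c ≡ cycleWeight B c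
  cycleWeight-cong (u₀ ∷ᵛ u₁ ∷ᵛ u₂ ∷ᵛ u₃ ∷ᵛ []ᵛ) =
    cong₂ _*ω_ (cong₂ _*ω_ (cong₂ _*ω_ (A≗B u₀ u₁) (A≗B u₁ u₂)) (A≗B u₂ u₃)) (A≗B u₃ u₀)

  cycleCoverExpansion-cong : cycleCoverExpansion A ≡ cycleCoverExpansion B
  cycleCoverExpansion-cong = cong₂ (λ m c → m +ω -ω c)
    (cong sum (List.map-cong matchingWeight-cong perfectMatchings))
    (cong sum (List.map-cong cycleWeight-cong hamiltonianCycles))

-- The matrix is rebuilt from its entries so that its diagonal can be rewritten.
det-zeroDiagonal : (A : Mat 4) → (∀ u → A u u ≡ 0ω) → det A ≡ cycleCoverExpansion A
det-zeroDiagonal A diagonal = begin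
  det A                                    ≡⟨⟩
  det (withDiagonal (tabulate λ u → A u u)) ≡⟨ cong (det ∘ withDiagonal) (Vecₚ.tabulate-cong diagonal) ⟩
  det hollowA                              ≡⟨ det-hollow (A 0F 1F) (A 0F 2F) (A 0F 3F) (A 1F 0F) (A 1F 2F) (A 1F 3F)
                                                           (A 2F 0F) (A 2F 1F) (A 2F 3F) (A 3F 0F) (A 3F 1F) (A 3F 2F) ⟩
  cycleCoverExpansion hollowA              ≡⟨ cycleCoverExpansion-cong hollowA≗A ⟩
  cycleCoverExpansion A                    ∎
  where
  open ≡-Reasoning
  withDiagonal : Vec ℤω 4 → Mat 4
  withDiagonal d = fromEntries (lookup d 0F) (A 0F 1F) (A 0F 2F) (A 0F 3F)
                               (A 1F 0F) (lookup d 1F) (A 1F 2F) (A 1F 3F)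
                               (A 2F 0F) (A 2F 1F) (lookup d 2F) (A 2F 3F)
                               (A 3F 0F) (A 3F 1F) (A 3F 2F) (lookup d 3F)
  hollowA : Mat 4
  hollowA = hollow 0ω (A 0F 1F) (A 0F 2F) (A 0F 3F) (A 1F 0F) (A 1F 2F) (A 1F 3F)
                      (A 2F 0F) (A 2F 1F) (A 2F 3F) (A 3F 0F) (A 3F 1F) (A 3F 2F)
  hollowA≗A : ∀ u v → hollowA u v ≡ A u v
  hollowA≗A = λ where
    0F 0F → sym (diagonal 0F) ; 0F 1F → refl ; 0F 2F → refl ; 0F 3F → refl
    1F 0F → refl ; 1F 1F → sym (diagonal 1F) ; 1F 2F → refl ; 1F 3F → refl
    2F 0F → refl ; 2F 1F → refl ; 2F 2F → sym (diagonal 2F) ; 2F 3F → refl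
    3F 0F → refl ; 3F 1F → refl ; 3F 2F → refl ; 3F 3F → sym (diagonal 3F)

switch : ∀ {n} → (Fin n → T6) → Mat n → Mat n
switch X A u v = ⟦ X u ⟧ *ω A u v *ω conj ⟦ X v ⟧

private
  regroup : ∀ x a y′ y b z′ → (x *ω a *ω y′) *ω (y *ω b *ω z′) ≡ x *ω (a *ω b) *ω z′ *ω (y′ *ω y)
  regroup = solve 6 (λ x a y′ y b z′ → (x ⊗ a ⊗ y′) ⊗ (y ⊗ b ⊗ z′) ⊜ x ⊗ (a ⊗ b) ⊗ z′ ⊗ (y′ ⊗ y)) refl
    where open ℤωSolver

  shift : ∀ x a x′ → x *ω a *ω x′ ≡ a *ω (x *ω x′)
  shift = solve 3 (λ x a x′ → x ⊗ a ⊗ x′ ⊜ a ⊗ (x ⊗ x′)) refl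
    where open ℤωSolver

switch-telescope : ∀ x y z a b →
  (⟦ x ⟧ *ω a *ω conj ⟦ y ⟧) *ω (⟦ y ⟧ *ω b *ω conj ⟦ z ⟧) ≡ ⟦ x ⟧ *ω (a *ω b) *ω conj ⟦ z ⟧
switch-telescope x y z a b = begin
  (⟦ x ⟧ *ω a *ω conj ⟦ y ⟧) *ω (⟦ y ⟧ *ω b *ω conj ⟦ z ⟧)  ≡⟨ regroup ⟦ x ⟧ a (conj ⟦ y ⟧) ⟦ y ⟧ b (conj ⟦ z ⟧) ⟩
  ⟦ x ⟧ *ω (a *ω b) *ω conj ⟦ z ⟧ *ω (conj ⟦ y ⟧ *ω ⟦ y ⟧) ≡⟨ cong (⟦ x ⟧ *ω (a *ω b) *ω conj ⟦ z ⟧ *ω_) (conj⟦⟧*⟦⟧≡1 y) ⟩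
  ⟦ x ⟧ *ω (a *ω b) *ω conj ⟦ z ⟧ *ω 1ω                     ≡⟨ *ω-identityʳ (⟦ x ⟧ *ω (a *ω b) *ω conj ⟦ z ⟧) ⟩
  ⟦ x ⟧ *ω (a *ω b) *ω conj ⟦ z ⟧                           ∎
  where open ≡-Reasoning

switch-closed : ∀ x a → ⟦ x ⟧ *ω a *ω conj ⟦ x ⟧ ≡ a
switch-closed x a = begin
  ⟦ x ⟧ *ω a *ω conj ⟦ x ⟧    ≡⟨ shift ⟦ x ⟧ a (conj ⟦ x ⟧) ⟩
  a *ω (⟦ x ⟧ *ω conj ⟦ x ⟧)  ≡⟨ cong (a *ω_) (⟦⟧*conj⟦⟧≡1 x) ⟩
  a *ω 1ω                     ≡⟨ *ω-identityʳ a ⟩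
  a                           ∎
  where open ≡-Reasoning

module _ (X : Fin 4 → T6) (A : Mat 4) where

  matchingWeight-switch : ∀ m → matchingWeight (switch X A) m ≡ matchingWeight A m
  matchingWeight-switch (u₀ ∷ᵛ u₁ ∷ᵛ u₂ ∷ᵛ u₃ ∷ᵛ []ᵛ) = cong₂ _*ω_ (closed₂ u₀ u₁) (closed₂ u₂ u₃)
    where
    closed₂ : ∀ u v → switch X A u v *ω switch X A v u ≡ A u v *ω A v u
    closed₂ u v = trans (switch-telescope (X u) (X v) (X u) (A u v) (A v u)) (switch-closed (X u) (A u v *ω A v u))

  cycleWeight-switch : ∀ c → cycleWeight (switch X A) c ≡ cycleWeight A c
  cycleWeight-switch (u₀ ∷ᵛ u₁ ∷ᵛ u₂ ∷ᵛ u₃ ∷ᵛ []ᵛ) = begin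
    ((s u₀ u₁ *ω s u₁ u₂) *ω s u₂ u₃) *ω s u₃ u₀
      ≡⟨ cong (λ w → (w *ω s u₂ u₃) *ω s u₃ u₀) (switch-telescope (X u₀) (X u₁) (X u₂) (A u₀ u₁) (A u₁ u₂)) ⟩
    ((⟦ X u₀ ⟧ *ω (A u₀ u₁ *ω A u₁ u₂) *ω conj ⟦ X u₂ ⟧) *ω s u₂ u₃) *ω s u₃ u₀
      ≡⟨ cong (_*ω s u₃ u₀) (switch-telescope (X u₀) (X u₂) (X u₃) (A u₀ u₁ *ω A u₁ u₂) (A u₂ u₃)) ⟩
    (⟦ X u₀ ⟧ *ω (A u₀ u₁ *ω A u₁ u₂ *ω A u₂ u₃) *ω conj ⟦ X u₃ ⟧) *ω s u₃ u₀
      ≡⟨ switch-telescope (X u₀) (X u₃) (X u₀) (A u₀ u₁ *ω A u₁ u₂ *ω A u₂ u₃) (A u₃ u₀) ⟩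
    ⟦ X u₀ ⟧ *ω (A u₀ u₁ *ω A u₁ u₂ *ω A u₂ u₃ *ω A u₃ u₀) *ω conj ⟦ X u₀ ⟧
      ≡⟨ switch-closed (X u₀) (A u₀ u₁ *ω A u₁ u₂ *ω A u₂ u₃ *ω A u₃ u₀) ⟩
    A u₀ u₁ *ω A u₁ u₂ *ω A u₂ u₃ *ω A u₃ u₀
      ∎
    where
    open ≡-Reasoning
    s = switch X A

  cycleCoverExpansion-switch : cycleCoverExpansion (switch X A) ≡ cycleCoverExpansion A
  cycleCoverExpansion-switch = cong₂ (λ m c → m +ω -ω c)
    (cong sum (List.map-cong matchingWeight-switch perfectMatchings))
    (cong sum (List.map-cong cycleWeight-switch hamiltonianCycles))

weight : Maybe T6 → ℤω
weight = Maybe.maybe ⟦_⟧ 0ω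

switchArc : T6 → T6 → Maybe T6 → Maybe T6
switchArc x y = Maybe.map (λ k → x · k · y ⁻¹)

switchArc-conj : ∀ x y m → switchArc y x (Maybe.map _⁻¹ m) ≡ Maybe.map _⁻¹ (switchArc x y m)
switchArc-conj x y nothing  = refl
switchArc-conj x y (just k) = cong just (inverse x k y)
  where
  inverse : ∀ x k y → y · k ⁻¹ · x ⁻¹ ≡ (x · k · y ⁻¹) ⁻¹
  inverse = from-yes (all? λ x → all? λ k → all? λ y → y · k ⁻¹ · x ⁻¹ ≟ᶠ (x · k · y ⁻¹) ⁻¹)

weight-switchArc : ∀ x y m → weight (switchArc x y m) ≡ ⟦ x ⟧ *ω weight m *ω conj ⟦ y ⟧
weight-switchArc x y nothing  = sym (trans (cong (_*ω conj ⟦ y ⟧) (zeroʳ ⟦ x ⟧)) (zeroˡ (conj ⟦ y ⟧)))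
weight-switchArc x y (just k) = ⟦⟧-switch x k y

switched : ∀ {n} → (Fin n → T6) → SignedDigraph n → SignedDigraph n
switched X Φ = record
  { arc      = λ u v → switchArc (X u) (X v) (arc Φ u v)
  ; loopless = λ u → cong (switchArc (X u) (X u)) (loopless Φ u)
  ; conjSym  = λ u v → trans (cong (switchArc (X v) (X u)) (conjSym Φ u v)) (switchArc-conj (X u) (X v) (arc Φ u v))
  }

Eis-switched : ∀ {n} X (Φ : SignedDigraph n) u v → Eis (switched X Φ) u v ≡ switch X (Eis Φ) u v
Eis-switched X Φ u v = weight-switchArc (X u) (X v) (arc Φ u v)

Eis-diagonal : ∀ {n} (Φ : SignedDigraph n) u → Eis Φ u u ≡ 0ω
Eis-diagonal Φ u = cong weight (loopless Φ u)

det-Eis : ∀ Φ → det (Eis Φ) ≡ cycleCoverExpansion (Eis Φ)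
det-Eis Φ = det-zeroDiagonal (Eis Φ) (Eis-diagonal Φ)

labels : SignedDigraph 4 → Vec (Maybe T6) 6
labels Φ = arc Φ 0F 1F ∷ᵛ arc Φ 0F 2F ∷ᵛ arc Φ 0F 3F ∷ᵛ arc Φ 1F 2F ∷ᵛ arc Φ 1F 3F ∷ᵛ arc Φ 2F 3F ∷ᵛ []ᵛ

fromPairs : {A : Set} → A → (A → A) → Vec A 6 → Fin 4 → Fin 4 → A
fromPairs o c (x₀₁ ∷ᵛ x₀₂ ∷ᵛ x₀₃ ∷ᵛ x₁₂ ∷ᵛ x₁₃ ∷ᵛ x₂₃ ∷ᵛ []ᵛ) =
  hollow o x₀₁ x₀₂ x₀₃ (c x₀₁) x₁₂ x₁₃ (c x₀₂) (c x₁₂) x₂₃ (c x₀₃) (c x₁₃) (c x₂₃)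

fromPairs-map : ∀ {A B : Set} (f : A → B) {o o′ c c′} → f o ≡ o′ → (∀ x → f (c x) ≡ c′ (f x)) →
                ∀ t u v → f (fromPairs o c t u v) ≡ fromPairs o′ c′ (Vec.map f t) u v
fromPairs-map f fo fc (x₀₁ ∷ᵛ x₀₂ ∷ᵛ x₀₃ ∷ᵛ x₁₂ ∷ᵛ x₁₃ ∷ᵛ x₂₃ ∷ᵛ []ᵛ) = λ where
  0F 0F → fo      ; 0F 1F → refl    ; 0F 2F → refl    ; 0F 3F → refl
  1F 0F → fc x₀₁  ; 1F 1F → fo      ; 1F 2F → refl    ; 1F 3F → refl
  2F 0F → fc x₀₂  ; 2F 1F → fc x₁₂  ; 2F 2F → fo      ; 2F 3F → refl
  3F 0F → fc x₀₃  ; 3F 1F → fc x₁₃  ; 3F 2F → fc x₂₃  ; 3F 3F → fo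

arcs : Vec (Maybe T6) 6 → Fin 4 → Fin 4 → Maybe T6
arcs = fromPairs nothing (Maybe.map _⁻¹)

arc-labels : ∀ Φ u v → arc Φ u v ≡ arcs (labels Φ) u v
arc-labels Φ = λ where
  0F 0F → loopless Φ 0F     ; 0F 1F → refl              ; 0F 2F → refl              ; 0F 3F → refl
  1F 0F → conjSym Φ 0F 1F   ; 1F 1F → loopless Φ 1F     ; 1F 2F → refl              ; 1F 3F → refl
  2F 0F → conjSym Φ 0F 2F   ; 2F 1F → conjSym Φ 1F 2F   ; 2F 2F → loopless Φ 2F     ; 2F 3F → refl
  3F 0F → conjSym Φ 0F 3F   ; 3F 1F → conjSym Φ 1F 3F   ; 3F 2F → conjSym Φ 2F 3F   ; 3F 3F → loopless Φ 3F

eisenstein : Vec (Maybe T6) 6 → Mat 4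
eisenstein t u v = weight (arcs t u v)

Eis-labels : ∀ Φ u v → Eis Φ u v ≡ eisenstein (labels Φ) u v
Eis-labels Φ u v = cong weight (arc-labels Φ u v)

-- The underlying simple graph, as the set of adjacent pairs among 01, 02, 03, 12, 13, 23.
shape : SignedDigraph 4 → Subset 6
shape Φ = Vec.map is-just (labels Φ)

edge : Subset 6 → Fin 4 → Fin 4 → Bool
edge = fromPairs outside id

edge-shape : ∀ Φ u v → edge (shape Φ) u v ≡ is-just (arc Φ u v)
edge-shape Φ u v = sym (trans (cong is-just (arc-labels Φ u v))
                              (fromPairs-map is-just {c′ = id} refl is-just-⁻¹ (labels Φ) u v))
  where
  is-just-⁻¹ : ∀ m → is-just (Maybe.map _⁻¹ m) ≡ is-just m
  is-just-⁻¹ nothing  = refl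
  is-just-⁻¹ (just _) = refl

Edge : Subset 6 → Fin 4 → Fin 4 → Set
Edge s u v = edge s u v ≡ true

ConnectedShape : Subset 6 → Set
ConnectedShape s = ∀ (S : Subset 4) → (∀ u v → Edge s u v → u ∈ S → v ∈ S) → 0F ∈ S → ∀ v → v ∈ S

TwinFreeShape : Subset 6 → Set
TwinFreeShape s = ∀ u v → u ≢ v → ¬ (∀ z → edge s u z ≡ edge s v z)

arcsAlong : Vec (Fin 4) 4 → List (Fin 4 × Fin 4)
arcsAlong (u₀ ∷ᵛ u₁ ∷ᵛ u₂ ∷ᵛ u₃ ∷ᵛ []ᵛ) = (u₀ , u₁) ∷ (u₁ , u₂) ∷ (u₂ , u₃) ∷ (u₃ , u₀) ∷ []

NonHamiltonian : Subset 6 → Set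
NonHamiltonian s = All (λ c → Any (uncurry λ u v → edge s u v ≡ false) (arcsAlong c)) hamiltonianCycles

indicator : Bool → ℤω
indicator true  = 1ω
indicator false = 0ω

matchingIndicator : Subset 6 → Vec (Fin 4) 4 → ℤω
matchingIndicator s (u₀ ∷ᵛ u₁ ∷ᵛ u₂ ∷ᵛ u₃ ∷ᵛ []ᵛ) = indicator (edge s u₀ u₁) *ω indicator (edge s u₂ u₃)

matchingCount : Subset 6 → ℤω
matchingCount s = sum (map (matchingIndicator s) perfectMatchings)

all-subsets? : ∀ {n} {P : Subset n → Set} → (∀ S → Dec (P S)) → Dec (∀ S → P S)
all-subsets? {zero}  P? = map′ (λ p → λ { []ᵛ → p }) (λ h → h []ᵛ) (P? []ᵛ)
all-subsets? {suc n} P? = map′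
  (λ (p , q) → λ { (inside ∷ᵛ S) → p S ; (outside ∷ᵛ S) → q S })
  (λ h → (λ S → h (inside ∷ᵛ S)) , (λ S → h (outside ∷ᵛ S)))
  (all-subsets? (P? ∘ (inside ∷ᵛ_)) ×-dec all-subsets? (P? ∘ (outside ∷ᵛ_)))

connected? : ∀ s → Dec (ConnectedShape s)
connected? s = all-subsets? λ S → closed? S →-dec (0F ∈? S →-dec all? (_∈? S))
  where
  closed? : ∀ S → Dec (∀ u v → Edge s u v → u ∈ S → v ∈ S)
  closed? S = all? λ u → all? λ v → (edge s u v Bool.≟ true) →-dec (u ∈? S →-dec v ∈? S)

twinFree? : ∀ s → Dec (TwinFreeShape s)
twinFree? s = all? λ u → all? λ v → ¬? (u ≟ᶠ v) →-dec ¬? (all? λ z → edge s u z Bool.≟ edge s v z)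

nonHamiltonian? : ∀ s → Dec (NonHamiltonian s)
nonHamiltonian? s =
  All.all? (λ c → Any.any? (uncurry λ u v → edge s u v Bool.≟ false) (arcsAlong c)) hamiltonianCycles

-- Up to relabelling these are K₄, the path P₄ and the triangle with a pendant edge.
connected-twinFree-shapes : ∀ s → ConnectedShape s → TwinFreeShape s →
                            s ≡ ⊤ ⊎ (NonHamiltonian s × matchingCount s ≡ 1ω)
connected-twinFree-shapes = from-yes (all-subsets? λ s →
  connected? s →-dec (twinFree? s →-dec
    (Vecₚ.≡-dec Bool._≟_ s ⊤ ⊎-dec (nonHamiltonian? s ×-dec matchingCount s ≟ω 1ω))))

is-just⇒true : ∀ {m : Maybe T6} → Is-just m → is-just m ≡ true
is-just⇒true {just _} _ = refl

connected⇒connectedShape : ∀ Φ → Connected Φ → ConnectedShape (shape Φ)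
connected⇒connectedShape Φ connected S closed 0∈S v = along (connected 0F v) 0∈S
  where
  along : ∀ {x y} → Star (Adjacent Φ) x y → x ∈ S → y ∈ S
  along ε                   x∈S = x∈S
  along (_◅_ {j = y} x~y w) x∈S = along w (closed _ y (trans (edge-shape Φ _ y) (is-just⇒true x~y)) x∈S)

-- When u and v have the same neighbours, switching by rotation (arc v z) (arc u z) at each z
-- turns the arcs out of v into those out of u.
rotation : Maybe T6 → Maybe T6 → T6
rotation (just β) (just α) = β · α ⁻¹
rotation _        _        = 0F

rotation-correct : ∀ α β → is-just α ≡ is-just β → weight α ≡ ⟦ 0F ⟧ *ω weight β *ω conj ⟦ rotation β α ⟧
rotation-correct nothing  nothing  _ = refl
rotation-correct (just α) (just β) _ = rotate α β
  where
  rotate : ∀ α β → ⟦ α ⟧ ≡ ⟦ 0F ⟧ *ω ⟦ β ⟧ *ω conj ⟦ β · α ⁻¹ ⟧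
  rotate = from-yes (all? λ α → all? λ β → ⟦ α ⟧ ≟ω ⟦ 0F ⟧ *ω ⟦ β ⟧ *ω conj ⟦ β · α ⁻¹ ⟧)

sameNeighbours⇒twins : ∀ {n} (Φ : SignedDigraph n) {u v} → u ≢ v →
                       (∀ z → is-just (arc Φ u z) ≡ is-just (arc Φ v z)) → Twins Φ u v
sameNeighbours⇒twins Φ {u} {v} u≢v same = u≢v , X , entry
  where
  X : _ → T6
  X z = rotation (arc Φ v z) (arc Φ u z)
  entry : ∀ z → Eis Φ u z ≡ ⟦ X v ⟧ *ω Eis Φ v z *ω conj ⟦ X z ⟧
  entry z = trans (rotation-correct (arc Φ u z) (arc Φ v z) (same z))
                  (cong (λ m → ⟦ rotation m (arc Φ u v) ⟧ *ω Eis Φ v z *ω conj ⟦ X z ⟧) (sym (loopless Φ v)))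

twinReduced⇒twinFreeShape : ∀ Φ → TwinReduced Φ → TwinFreeShape (shape Φ)
twinReduced⇒twinFreeShape Φ reduced u v u≢v sameEdges = reduced u v (sameNeighbours⇒twins Φ u≢v λ z →
  trans (sym (edge-shape Φ u z)) (trans (sameEdges z) (edge-shape Φ v z)))

weight-pair : ∀ m → weight m *ω weight (Maybe.map _⁻¹ m) ≡ indicator (is-just m)
weight-pair nothing  = refl
weight-pair (just x) = ⟦⟧*⟦⁻¹⟧≡1 x

zero-factorˡ : ∀ {x} y → x ≡ 0ω → x *ω y ≡ 0ω
zero-factorˡ y refl = zeroˡ y

zero-factorʳ : ∀ x {y} → y ≡ 0ω → x *ω y ≡ 0ω
zero-factorʳ x refl = zeroʳ x

cycleWeight-vanishes : ∀ (A : Mat 4) c → Any (uncurry λ u v → A u v ≡ 0ω) (arcsAlong c) → cycleWeight A c ≡ 0ω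
cycleWeight-vanishes A (u₀ ∷ᵛ u₁ ∷ᵛ u₂ ∷ᵛ u₃ ∷ᵛ []ᵛ) = λ
  { (here a≡0)                         → zero-factorˡ d (zero-factorˡ c (zero-factorˡ b a≡0))
  ; (there (here b≡0))                 → zero-factorˡ d (zero-factorˡ c (zero-factorʳ a b≡0))
  ; (there (there (here c≡0)))         → zero-factorˡ d (zero-factorʳ (a *ω b) c≡0)
  ; (there (there (there (here d≡0)))) → zero-factorʳ (a *ω b *ω c) d≡0
  }
  where
  a = A u₀ u₁ ; b = A u₁ u₂ ; c = A u₂ u₃ ; d = A u₃ u₀

sum-zeros : ∀ {xs} → All (_≡ 0ω) xs → sum xs ≡ 0ω
sum-zeros []           = refl
sum-zeros (refl ∷ x≡0) = cong (0ω +ω_) (sum-zeros x≡0)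

module _ (Φ : SignedDigraph 4) where

  matchingWeight-Eis : ∀ m → matchingWeight (Eis Φ) m ≡ matchingIndicator (shape Φ) m
  matchingWeight-Eis (u₀ ∷ᵛ u₁ ∷ᵛ u₂ ∷ᵛ u₃ ∷ᵛ []ᵛ) = cong₂ _*ω_ (pair u₀ u₁) (pair u₂ u₃)
    where
    pair : ∀ u v → Eis Φ u v *ω Eis Φ v u ≡ indicator (edge (shape Φ) u v)
    pair u v = begin
      Eis Φ u v *ω Eis Φ v u                                   ≡⟨ cong (λ m → Eis Φ u v *ω weight m) (conjSym Φ u v) ⟩
      weight (arc Φ u v) *ω weight (Maybe.map _⁻¹ (arc Φ u v)) ≡⟨ weight-pair (arc Φ u v) ⟩
      indicator (is-just (arc Φ u v))                          ≡⟨ cong indicator (edge-shape Φ u v) ⟨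
      indicator (edge (shape Φ) u v)                           ∎
      where open ≡-Reasoning

  Eis-absent : ∀ u v → edge (shape Φ) u v ≡ false → Eis Φ u v ≡ 0ω
  Eis-absent u v absent = cong weight (nothing-if-absent (arc Φ u v) (trans (sym (edge-shape Φ u v)) absent))
    where
    nothing-if-absent : ∀ m → is-just m ≡ false → m ≡ nothing
    nothing-if-absent nothing _ = refl

  cycleCoverExpansion-nonHamiltonian : NonHamiltonian (shape Φ) → cycleCoverExpansion (Eis Φ) ≡ matchingCount (shape Φ)
  cycleCoverExpansion-nonHamiltonian noCycle = begin
    cycleCoverExpansion (Eis Φ)
      ≡⟨ cong₂ (λ m c → m +ω -ω c) (cong sum (List.map-cong matchingWeight-Eis perfectMatchings))
                                    (sum-zeros (All.map⁺ (All.map cycleVanishes noCycle))) ⟩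
    matchingCount (shape Φ) +ω 0ω
      ≡⟨ +-identityʳ _ ⟩
    matchingCount (shape Φ)
      ∎
    where
    open ≡-Reasoning
    cycleVanishes : ∀ {c} → Any (uncurry λ u v → edge (shape Φ) u v ≡ false) (arcsAlong c) → cycleWeight (Eis Φ) c ≡ 0ω
    cycleVanishes {c} absent = cycleWeight-vanishes (Eis Φ) c (Any.map (λ { {u , v} → Eis-absent u v }) absent)

all-just : ∀ {n} (t : Vec (Maybe T6) n) → Vec.map is-just t ≡ ⊤ → ∃ λ ℓ → t ≡ Vec.map just ℓ
all-just []ᵛ         _  = []ᵛ , refl
all-just (just x ∷ᵛ t) eq with all-just t (Vecₚ.∷-injectiveʳ eq)
... | ℓ , refl = x ∷ᵛ ℓ , refl

-- Switching by these exponents at vertices 1, 2, 3 turns arcs a, b, c out of vertex 0 into 1.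
fromVertex0 : T6 → T6 → T6 → Fin 4 → T6
fromVertex0 a b c = λ where
  0F → 0F ; 1F → a ; 2F → b ; 3F → c

normalForm : T6 → T6 → T6 → Vec (Maybe T6) 6
normalForm p q r = just 0F ∷ᵛ just 0F ∷ᵛ just 0F ∷ᵛ just p ∷ᵛ just q ∷ᵛ just r ∷ᵛ []ᵛ

labels-normalised : ∀ Φ {a b c d e f} → labels Φ ≡ Vec.map just (a ∷ᵛ b ∷ᵛ c ∷ᵛ d ∷ᵛ e ∷ᵛ f ∷ᵛ []ᵛ) →
  labels (switched (fromVertex0 a b c) Φ) ≡ normalForm (a · d · b ⁻¹) (a · e · c ⁻¹) (b · f · c ⁻¹)
labels-normalised Φ {a} {b} {c} eq =
  trans (cong (switchLabels (fromVertex0 a b c)) eq)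
        (cong₂ _∷ᵛ_ (cancel a) (cong₂ _∷ᵛ_ (cancel b) (cong₂ _∷ᵛ_ (cancel c) refl)))
  where
  switchLabels : (Fin 4 → T6) → Vec (Maybe T6) 6 → Vec (Maybe T6) 6
  switchLabels X (x₀₁ ∷ᵛ x₀₂ ∷ᵛ x₀₃ ∷ᵛ x₁₂ ∷ᵛ x₁₃ ∷ᵛ x₂₃ ∷ᵛ []ᵛ) =
    switchArc (X 0F) (X 1F) x₀₁ ∷ᵛ switchArc (X 0F) (X 2F) x₀₂ ∷ᵛ switchArc (X 0F) (X 3F) x₀₃ ∷ᵛ
    switchArc (X 1F) (X 2F) x₁₂ ∷ᵛ switchArc (X 1F) (X 3F) x₁₃ ∷ᵛ switchArc (X 2F) (X 3F) x₂₃ ∷ᵛ []ᵛ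
  cancel : ∀ x → just (0F · x · x ⁻¹) ≡ just 0F
  cancel x = cong just (from-yes (all? λ x → 0F · x · x ⁻¹ ≟ᶠ 0F) x)

relabellings : List (Permutation′ 4)
relabellings = Perm.id ∷ transpose 1F 2F ∷ transpose 1F 3F ∷ transpose 2F 3F ∷
               (transpose 1F 2F ∘ₚ transpose 2F 3F) ∷ (transpose 2F 3F ∘ₚ transpose 1F 2F) ∷ []

Certificate : T6 → Mat 4 → Mat 4 → Set
Certificate k A B =
  Any (λ σ → ∀ u v → B u v ≡ switch (fromVertex0 k k k) (λ u v → A (σ ⟨$⟩ʳ u) (σ ⟨$⟩ʳ v)) u v) relabellings

certificate? : ∀ k A B → Dec (Certificate k A B)
certificate? k A B = Any.any? (λ σ → all? λ u → all? λ v →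
  B u v ≟ω switch (fromVertex0 k k k) (λ u v → A (σ ⟨$⟩ʳ u) (σ ⟨$⟩ʳ v)) u v) relabellings

certificate⇒isomorphic : ∀ {k A B} → Certificate k A B → SwitchingIsomorphic A B
certificate⇒isomorphic {k} cert with satisfied cert
... | σ , B≡ = relabel σ (λ _ _ → refl) ◅ switching (fromVertex0 k k k) B≡ ◅ ε

-- (T₄,+) is reached with ω⁵ and (T₄,−) with ω² at the vertices 1, 2, 3 (found by the search).
normalForms-classification : ∀ p q r → let N = eisenstein (normalForm p q r) in
  cycleCoverExpansion N ≡ 0ω → Certificate 5F N T4+ ⊎ Certificate 2F N T4-
normalForms-classification = from-yes (all? λ p → all? λ q → all? λ r →
  let N = eisenstein (normalForm p q r) in
  (cycleCoverExpansion N ≟ω 0ω) →-dec (certificate? 5F N T4+ ⊎-dec certificate? 2F N T4-))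

complete-case : ∀ Φ {ℓ} → labels Φ ≡ Vec.map just ℓ → det (Eis Φ) ≡ 0ω →
                SwitchingIsomorphic (Eis Φ) T4+ ⊎ SwitchingIsomorphic (Eis Φ) T4-
complete-case Φ {a ∷ᵛ b ∷ᵛ c ∷ᵛ d ∷ᵛ e ∷ᵛ f ∷ᵛ []ᵛ} eq det≡0 =
  Sum.map (λ cert → toNormal ◅◅ certificate⇒isomorphic cert) (λ cert → toNormal ◅◅ certificate⇒isomorphic cert)
          (normalForms-classification p q r expansion≡0)
  where
  p = a · d · b ⁻¹ ; q = a · e · c ⁻¹ ; r = b · f · c ⁻¹
  X = fromVertex0 a b c
  N = eisenstein (normalForm p q r)
  Eis≗N : ∀ u v → Eis (switched X Φ) u v ≡ N u v
  Eis≗N u v = trans (Eis-labels (switched X Φ) u v) (cong (λ t → eisenstein t u v) (labels-normalised Φ eq))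
  toNormal : SwitchingIsomorphic (Eis Φ) N
  toNormal = switching X (Eis-switched X Φ) ◅ relabel Perm.id (λ u v → sym (Eis≗N u v)) ◅ ε
  expansion≡0 : cycleCoverExpansion N ≡ 0ω
  expansion≡0 = begin
    cycleCoverExpansion N                   ≡⟨ cycleCoverExpansion-cong Eis≗N ⟨
    cycleCoverExpansion (Eis (switched X Φ)) ≡⟨ cycleCoverExpansion-cong (Eis-switched X Φ) ⟩
    cycleCoverExpansion (switch X (Eis Φ))   ≡⟨ cycleCoverExpansion-switch X (Eis Φ) ⟩
    cycleCoverExpansion (Eis Φ)              ≡⟨ det-Eis Φ ⟨
    det (Eis Φ)                              ≡⟨ det≡0 ⟩
    0ω                                       ∎
    where open ≡-Reasoning

proposition4p6 : (Φ : SignedDigraph 4) → Connected Φ → TwinReduced Φ →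
    HasRank (Eis Φ) 3 →
    SwitchingIsomorphic (Eis Φ) T4+ ⊎ SwitchingIsomorphic (Eis Φ) T4-
proposition4p6 Φ connected reduced rank = byShape (connected-twinFree-shapes (shape Φ)
  (connected⇒connectedShape Φ connected) (twinReduced⇒twinFreeShape Φ reduced))
  where
  -- The whole matrix is one of its own 4 × 4 minors.
  det≡0 : det (Eis Φ) ≡ 0ω
  det≡0 = proj₂ rank (λ i → i) (λ i → i)
  1ω≢0ω : 1ω ≢ 0ω
  1ω≢0ω ()
  byShape : shape Φ ≡ ⊤ ⊎ (NonHamiltonian (shape Φ) × matchingCount (shape Φ) ≡ 1ω) →
            SwitchingIsomorphic (Eis Φ) T4+ ⊎ SwitchingIsomorphic (Eis Φ) T4-
  byShape (inj₁ complete)                 = complete-case Φ (proj₂ (all-just (labels Φ) complete)) det≡0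
  byShape (inj₂ (noCycle , oneMatching)) = ⊥-elim (1ω≢0ω (begin
    1ω                          ≡⟨ oneMatching ⟨
    matchingCount (shape Φ)     ≡⟨ cycleCoverExpansion-nonHamiltonian Φ noCycle ⟨
    cycleCoverExpansion (Eis Φ) ≡⟨ det-Eis Φ ⟨
    det (Eis Φ)                 ≡⟨ det≡0 ⟩
    0ω                          ∎))
    where open ≡-Reasoning
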